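{- Let $\Theta=(\Sigma,\mathit{sim},\mathit{ser})$ be a comtrace alphabet and let $A\in\mathbb{S}$ be a step that is not indivisible. Then there exist two steps $B,C\in\mathbb{S}$ such that $A\sim_\Theta BC$ (that is, $A=B\cup C$ and $B\times C\subseteq\mathit{ser}$). Moreover, $A/_{\equiv_A}=B/_{\equiv_B}\cup C/_{\equiv_C}$.
   Context: A comtrace alphabet is $\Theta=(\Sigma,\mathit{sim},\mathit{ser})$ with $\Sigma$ finite nonempty, $\mathit{ser}\subseteq\mathit{sim}\subseteq\Sigma\times\Sigma$, $\mathit{sim}$ irreflexive and symmetric. $\mathbb{S}$ is the set of steps: nonempty $A\subseteq\Sigma$ with $(a,b)\in\mathit{sim}$ for all distinct $a,b\in A$. The relation $\sim_\Theta$ on step sequences: $uABz\sim_\Theta u(A\cup B)z$ for $A,B\in\mathbb{S}$ with $A\times B\subseteq\mathit{ser}$ (it is used symmetrically here). Let $\mathit{sin}=\mathit{sim}\setminus\mathit{ser}$. For a step $A$, $\equiv_A$ is the equivalence relation on $A$ given by $a\equiv_A b$ iff $(a,b)\in R^*$ and $(b,a)\in R^*$, with $R=\mathit{sin}\cap(A\times A)$ and $R^*$ its reflexive transitive closure; $A/_{\equiv_A}$ denotes the set of its equivalence classes. A step $A$ is indivisible if $\equiv_A$ has a single class. -}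

module Defs where

open import Data.Nat using (ℕ; suc)
open import Data.Bool using (Bool; true; false)
open import Data.Fin using (Fin)
open import Data.Fin.Subset using (Subset; _∈_; _∉_; Nonempty)
open import Data.Product using (_×_; Σ; ∃-syntax)
open import Relation.Nullary using (¬_)
open import Relation.Binary.PropositionalEquality using (_≡_)
open import Relation.Binary.Construct.Closure.ReflexiveTransitive using (Star)

record ComtraceAlphabet (m : ℕ) : Set where
  field
    sim : Fin (suc m) → Fin (suc m) → Bool
    ser : Fin (suc m) → Fin (suc m) → Bool
    ser⊆sim : ∀ a b → ser a b ≡ true → sim a b ≡ true
    sim-irrefl : ∀ a → sim a a ≡ false
    sim-sym : ∀ a b → sim a b ≡ sim b a

module _ {m : ℕ} (Θ : ComtraceAlphabet m) where
  open ComtraceAlphabet Θ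

  private
    Σ' : Set
    Σ' = Fin (suc m)

  Sim Ser Sin : Σ' → Σ' → Set
  Sim a b = sim a b ≡ true
  Ser a b = ser a b ≡ true
  Sin a b = (sim a b ≡ true) × (ser a b ≡ false)

  IsStep : Subset (suc m) → Set
  IsStep A = Nonempty A × (∀ a b → a ∈ A → b ∈ A → ¬ (a ≡ b) → Sim a b)

  SinIn : Subset (suc m) → Σ' → Σ' → Set
  SinIn A a b = Sin a b × a ∈ A × b ∈ A

  EquivIn : Subset (suc m) → Σ' → Σ' → Set
  EquivIn A a b = a ∈ A × b ∈ A × Star (SinIn A) a b × Star (SinIn A) b a

  Indivisible : Subset (suc m) → Set
  Indivisible A = ∀ a b → a ∈ A → b ∈ A → EquivIn A a b

  IsClassOf : Subset (suc m) → Subset (suc m) → Set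
  IsClassOf A X = Σ Σ' λ a → a ∈ A × (∀ x → (x ∈ X → EquivIn A x a) × (EquivIn A x a → x ∈ X))

-- A non-indivisible step A contains p, q with no sin-path from p to q inside A.
-- Let C be the set of elements of A that reach q by a sin-path and B = A ∖ C.
-- C is closed under sin-predecessors in A, so no pair of B × C is in sin; as
-- A is a step, B × C ⊆ ser. A sin-path ending in C stays in C and one starting
-- in B stays in B, so every ≡_A-class lies in B or in C and is an ≡_B- or
-- ≡_C-class there, and conversely.
module Submission where

open import Defs
open import Data.Nat using (ℕ; suc)
open import Data.Bool using (true; false)
open import Data.Bool.Properties using (¬-not) renaming (_≟_ to _≟ᵇ_)
open import Data.Fin using (Fin)
open import Data.Fin.Subset using (Subset; _∈_; _∉_; _⊆_; _⊂_; _⊃_; _∪_; _∩_; ∁; ⁅_⁆; Nonempty)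
open import Data.Fin.Subset.Properties
  using (_∈?_; ⊆-antisym; p⊆p∪q; x∈p∪q⁺; x∈p∪q⁻; x∈⁅x⁆; x∈⁅y⁆⇒x≡y;
         p∩q⊆p; x∈p∩q⁺; x∈p∩q⁻; x∈∁p⇒x∉p; x∉p⇒x∈∁p)
open import Data.Fin.Subset.Induction using (⊃-wellFounded)
open import Data.Fin.Properties using (any?)
open import Data.Product using (_×_; Σ; ∃; ∃₂; _,_; proj₁; proj₂)
import Data.Product as Product
open import Data.Sum using (_⊎_; inj₁; inj₂; [_,_]′)
open import Data.Empty using (⊥-elim)
open import Function using (_∘_; _⇔_; mk⇔; Equivalence)
open import Induction.WellFounded using (Acc; acc)
open import Level using (Level)
open import Relation.Nullary using (¬_; yes; no)
open import Relation.Nullary.Decidable using (_×-dec_; ¬?; decidable-stable)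
import Relation.Nullary.Decidable as Dec
open import Relation.Binary.Core using (Rel)
open import Relation.Binary.Definitions using (Decidable)
open import Relation.Binary.PropositionalEquality using (_≡_; refl)
open import Relation.Binary.Construct.Closure.ReflexiveTransitive using (Star; ε; _◅_)
import Relation.Binary.Construct.Closure.ReflexiveTransitive as Star

module _ {n : ℕ} {ℓ : Level} (R : Rel (Fin n) ℓ) where

  PredClosed SuccClosed : Subset n → Set ℓ
  PredClosed S = ∀ {x y} → R x y → y ∈ S → x ∈ S
  SuccClosed S = ∀ {x y} → R x y → x ∈ S → y ∈ S

  PredClosed-Star : ∀ {S x y} → PredClosed S → Star R x y → y ∈ S → x ∈ S
  PredClosed-Star closed ε         y∈S = y∈S
  PredClosed-Star closed (xRz ◅ p) y∈S = closed xRz (PredClosed-Star closed p y∈S)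

  SuccClosed-Star : ∀ {S x y} → SuccClosed S → Star R x y → x ∈ S → y ∈ S
  SuccClosed-Star closed ε         x∈S = x∈S
  SuccClosed-Star closed (xRz ◅ p) x∈S = SuccClosed-Star closed p (closed xRz x∈S)

module Reaching {n : ℕ} {ℓ : Level} {R : Rel (Fin n) ℓ} (R? : Decidable R) where

  predClosed? : (S : Subset n) →
                PredClosed R S ⊎ ∃₂ λ x y → R x y × y ∈ S × x ∉ S
  predClosed? S with any? (λ x → any? λ y → R? x y ×-dec y ∈? S ×-dec ¬? (x ∈? S))
  ... | yes (x , y , escape) = inj₂ (x , y , escape)
  ... | no ¬escape = inj₁ λ {x} {y} xRy y∈S →
          decidable-stable (x ∈? S) λ x∉S → ¬escape (x , y , xRy , y∈S , x∉S)

  AllReach : Fin n → Subset n → Set ℓ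
  AllReach t S = ∀ {x} → x ∈ S → Star R x t

  saturate : ∀ {t} (S : Subset n) → Acc _⊃_ S → AllReach t S → t ∈ S →
             ∃ λ T → AllReach t T × PredClosed R T × t ∈ T
  saturate {t} S (acc rec) reach t∈S with predClosed? S
  ... | inj₁ closed = S , reach , closed , t∈S
  ... | inj₂ (x , y , xRy , y∈S , x∉S) =
        saturate (S ∪ ⁅ x ⁆) (rec S⊂S∪x) reach′ (p⊆p∪q ⁅ x ⁆ t∈S)
    where
      S⊂S∪x : S ⊂ S ∪ ⁅ x ⁆
      S⊂S∪x = p⊆p∪q ⁅ x ⁆ , x , x∈p∪q⁺ (inj₂ (x∈⁅x⁆ x)) , x∉S

      reach′ : AllReach t (S ∪ ⁅ x ⁆)
      reach′ z∈ with x∈p∪q⁻ S ⁅ x ⁆ z∈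
      ... | inj₁ z∈S = reach z∈S
      ... | inj₂ z∈⁅x⁆ with refl ← x∈⁅y⁆⇒x≡y x z∈⁅x⁆ = xRy ◅ reach y∈S

  reachClosure : ∀ t → ∃ λ T → AllReach t T × PredClosed R T × t ∈ T
  reachClosure t = saturate ⁅ t ⁆ (⊃-wellFounded ⁅ t ⁆) singleton-reaches (x∈⁅x⁆ t)
    where
      singleton-reaches : AllReach t ⁅ t ⁆
      singleton-reaches x∈⁅t⁆ with refl ← x∈⁅y⁆⇒x≡y t x∈⁅t⁆ = ε

  reaching : Fin n → Subset n
  reaching t = proj₁ (reachClosure t)

  ∈-reaching : ∀ {x t} → x ∈ reaching t ⇔ Star R x t
  ∈-reaching {t = t} with reachClosure t
  ... | _ , reaches , closed , t∈T = mk⇔ reaches (λ x→t → PredClosed-Star R closed x→t t∈T)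

  star? : Decidable (Star R)
  star? x t = Dec.map ∈-reaching (x ∈? reaching t)

module _ {m : ℕ} (Θ : ComtraceAlphabet m) where
  open ComtraceAlphabet Θ

  private
    variable
      A S X : Subset (suc m)
      x y : Fin (suc m)

  SinIn? : (A : Subset (suc m)) → Decidable (SinIn Θ A)
  SinIn? A x y = ((sim x y ≟ᵇ true) ×-dec (ser x y ≟ᵇ false)) ×-dec (x ∈? A ×-dec y ∈? A)

  Star-SinIn? : (A : Subset (suc m)) → Decidable (Star (SinIn Θ A))
  Star-SinIn? A = Reaching.star? (SinIn? A)

  Star-SinIn-source : Star (SinIn Θ A) x y → y ∈ A → x ∈ A
  Star-SinIn-source ε                   y∈A = y∈A
  Star-SinIn-source ((_ , x∈A , _) ◅ _) _   = x∈A

  Star-SinIn-mono : S ⊆ A → Star (SinIn Θ S) x y → Star (SinIn Θ A) x y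
  Star-SinIn-mono S⊆A = Star.map λ (s , x∈S , y∈S) → s , S⊆A x∈S , S⊆A y∈S

  EquivIn-mono : S ⊆ A → EquivIn Θ S x y → EquivIn Θ A x y
  EquivIn-mono S⊆A (x∈S , y∈S , x→y , y→x) =
    S⊆A x∈S , S⊆A y∈S , Star-SinIn-mono S⊆A x→y , Star-SinIn-mono S⊆A y→x

  Star-SinIn-restrictᵖ : PredClosed (SinIn Θ A) S →
                         Star (SinIn Θ A) x y → y ∈ S → Star (SinIn Θ S) x y
  Star-SinIn-restrictᵖ closed ε                   y∈S = ε
  Star-SinIn-restrictᵖ {S = S} closed (_◅_ {j = z} xRz@(s , _) z→y) y∈S =
    (s , closed xRz z∈S , z∈S) ◅ Star-SinIn-restrictᵖ closed z→y y∈S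
    where
      z∈S : z ∈ S
      z∈S = PredClosed-Star _ closed z→y y∈S

  Star-SinIn-restrictˢ : SuccClosed (SinIn Θ A) S →
                         Star (SinIn Θ A) x y → x ∈ S → Star (SinIn Θ S) x y
  Star-SinIn-restrictˢ closed ε                   x∈S = ε
  Star-SinIn-restrictˢ closed (xRz@(s , _) ◅ z→y) x∈S =
    (s , x∈S , closed xRz x∈S) ◅ Star-SinIn-restrictˢ closed z→y (closed xRz x∈S)

  ClassUnion : Subset (suc m) → Subset (suc m) → Set
  ClassUnion A S = ∀ {x a} → a ∈ S → EquivIn Θ A x a → EquivIn Θ S x a

  PredClosed⇒ClassUnion : PredClosed (SinIn Θ A) S → ClassUnion A S
  PredClosed⇒ClassUnion {S = S} closed {x} a∈S (_ , _ , x→a , a→x) =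
    x∈S , a∈S , Star-SinIn-restrictᵖ closed x→a a∈S , Star-SinIn-restrictᵖ closed a→x x∈S
    where
      x∈S : x ∈ S
      x∈S = PredClosed-Star _ closed x→a a∈S

  SuccClosed⇒ClassUnion : SuccClosed (SinIn Θ A) S → ClassUnion A S
  SuccClosed⇒ClassUnion {S = S} closed {x} a∈S (_ , _ , x→a , a→x) =
    x∈S , a∈S , Star-SinIn-restrictˢ closed x→a x∈S , Star-SinIn-restrictˢ closed a→x a∈S
    where
      x∈S : x ∈ S
      x∈S = SuccClosed-Star _ closed a→x a∈S

  IsClassOf-⊇ : S ⊆ A → ClassUnion A S → IsClassOf Θ S X → IsClassOf Θ A X
  IsClassOf-⊇ S⊆A union (a , a∈S , class) =
    a , S⊆A a∈S , λ x → Product.map (EquivIn-mono S⊆A ∘_) (_∘ union a∈S) (class x)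

  IsClassOf-⊆ : S ⊆ A → ClassUnion A S →
                (X∈A/≡ : IsClassOf Θ A X) → proj₁ X∈A/≡ ∈ S → IsClassOf Θ S X
  IsClassOf-⊆ S⊆A union (a , _ , class) a∈S =
    a , a∈S , λ x → Product.map (union a∈S ∘_) (_∘ EquivIn-mono S⊆A) (class x)

  IsStep-⊆ : S ⊆ A → Nonempty S → IsStep Θ A → IsStep Θ S
  IsStep-⊆ S⊆A S≢∅ (_ , A-sim) = S≢∅ , λ a b a∈S b∈S → A-sim a b (S⊆A a∈S) (S⊆A b∈S)

  unreachablePair : ¬ Indivisible Θ A →
                    ∃₂ λ p q → p ∈ A × q ∈ A × ¬ Star (SinIn Θ A) p q
  unreachablePair {A} ¬indivisible
    with any? (λ p → any? λ q → p ∈? A ×-dec q ∈? A ×-dec ¬? (Star-SinIn? A p q))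
  ... | yes (p , q , unreachable) = p , q , unreachable
  ... | no none = ⊥-elim (¬indivisible λ a b a∈A b∈A →
          a∈A , b∈A , connected a∈A b∈A , connected b∈A a∈A)
    where
      connected : ∀ {a b} → a ∈ A → b ∈ A → Star (SinIn Θ A) a b
      connected {a} {b} a∈A b∈A =
        decidable-stable (Star-SinIn? A a b) λ a↛b → none (a , b , a∈A , b∈A , a↛b)

  module Split (A : Subset (suc m)) {q : Fin (suc m)} (q∈A : q ∈ A) where
    open Reaching (SinIn? A)

    C B : Subset (suc m)
    C = reaching q
    B = A ∩ ∁ C

    ∈C⁺ : Star (SinIn Θ A) x q → x ∈ C
    ∈C⁺ = Equivalence.from ∈-reaching

    ∈C⁻ : x ∈ C → Star (SinIn Θ A) x q
    ∈C⁻ = Equivalence.to ∈-reaching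

    C⊆A : C ⊆ A
    C⊆A x∈C = Star-SinIn-source (∈C⁻ x∈C) q∈A

    B⊆A : B ⊆ A
    B⊆A = p∩q⊆p A (∁ C)

    ∈B⁺ : x ∈ A → x ∉ C → x ∈ B
    ∈B⁺ x∈A x∉C = x∈p∩q⁺ (x∈A , x∉p⇒x∈∁p x∉C)

    ∈B⇒∉C : x ∈ B → x ∉ C
    ∈B⇒∉C x∈B = x∈∁p⇒x∉p (proj₂ (x∈p∩q⁻ A (∁ C) x∈B))

    C-predClosed : PredClosed (SinIn Θ A) C
    C-predClosed xRy y∈C = ∈C⁺ (xRy ◅ ∈C⁻ y∈C)

    B-succClosed : SuccClosed (SinIn Θ A) B
    B-succClosed xRy@(_ , _ , y∈A) x∈B = ∈B⁺ y∈A λ y∈C → ∈B⇒∉C x∈B (C-predClosed xRy y∈C)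

    C-classUnion : ClassUnion A C
    C-classUnion = PredClosed⇒ClassUnion C-predClosed

    B-classUnion : ClassUnion A B
    B-classUnion = SuccClosed⇒ClassUnion B-succClosed

    A≡B∪C : A ≡ B ∪ C
    A≡B∪C = ⊆-antisym A⊆B∪C ([ B⊆A , C⊆A ]′ ∘ x∈p∪q⁻ B C)
      where
        A⊆B∪C : A ⊆ B ∪ C
        A⊆B∪C {x} x∈A with x ∈? C
        ... | yes x∈C = x∈p∪q⁺ (inj₂ x∈C)
        ... | no x∉C  = x∈p∪q⁺ (inj₁ (∈B⁺ x∈A x∉C))

    B×C⊆Ser : IsStep Θ A → ∀ b c → b ∈ B → c ∈ C → Ser Θ b c
    B×C⊆Ser (_ , A-sim) b c b∈B c∈C = ¬-not λ ser≡false →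
      ∈B⇒∉C b∈B (C-predClosed ((sim-bc , ser≡false) , B⊆A b∈B , C⊆A c∈C) c∈C)
      where
        sim-bc : Sim Θ b c
        sim-bc = A-sim b c (B⊆A b∈B) (C⊆A c∈C) λ { refl → ∈B⇒∉C b∈B c∈C }

    classOf-A⇒B⊎C : IsClassOf Θ A X → IsClassOf Θ B X ⊎ IsClassOf Θ C X
    classOf-A⇒B⊎C X∈A/≡@(a , a∈A , _) with a ∈? C
    ... | yes a∈C = inj₂ (IsClassOf-⊆ C⊆A C-classUnion X∈A/≡ a∈C)
    ... | no a∉C  = inj₁ (IsClassOf-⊆ B⊆A B-classUnion X∈A/≡ (∈B⁺ a∈A a∉C))

    classOf-B⊎C⇒A : IsClassOf Θ B X ⊎ IsClassOf Θ C X → IsClassOf Θ A X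
    classOf-B⊎C⇒A = [ IsClassOf-⊇ B⊆A B-classUnion
                    , IsClassOf-⊇ C⊆A C-classUnion ]′

lemma3p4 : {m : ℕ} (Θ : ComtraceAlphabet m) (A : Subset _) →
    IsStep Θ A → ¬ Indivisible Θ A →
    Σ (Subset _) λ B → Σ (Subset _) λ C →
      IsStep Θ B × IsStep Θ C × A ≡ B ∪ C
      × (∀ b c → b ∈ B → c ∈ C → Ser Θ b c)
      × (∀ X → IsClassOf Θ A X → IsClassOf Θ B X ⊎ IsClassOf Θ C X)
      × (∀ X → IsClassOf Θ B X ⊎ IsClassOf Θ C X → IsClassOf Θ A X)
lemma3p4 Θ A A-step ¬indivisible with unreachablePair Θ ¬indivisible
... | p , q , p∈A , q∈A , p↛q =
  B , C , IsStep-⊆ Θ B⊆A (p , p∈B) A-step , IsStep-⊆ Θ C⊆A (q , ∈C⁺ ε) A-step ,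
  A≡B∪C , B×C⊆Ser A-step , (λ _ → classOf-A⇒B⊎C) , (λ _ → classOf-B⊎C⇒A)
  where
    open Split Θ A q∈A
    p∈B : p ∈ B
    p∈B = ∈B⁺ p∈A (p↛q ∘ ∈C⁻)
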